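{- Let $D$ be a positive integer and $K=\mathbb{Q}(i\sqrt{D})$. Let $C_1$ be the line $\Re z=0$ with interior $\{\Re z<0\}$, $C_2$ the line $\Re z=1$ with interior $\{\Re z>1\}$, $C_3$ the circle of center $1/2$ and radius $1/2$, and $C_4$ the circle of center $1/2+i\sqrt{D}$ and radius $1/2$, both positively oriented (interior containing the center). Let $L$ be the set of oriented circles $C$ with $\mathbf{v}_C\in\mathbb{Z}\mathbf{v}_{C_1}+\mathbb{Z}\mathbf{v}_{C_2}+\mathbb{Z}\mathbf{v}_{C_3}+\mathbb{Z}\mathbf{v}_{C_4}$, and let the Baragar–Lautzenheiser packing of parameter $D$ be the set of positively oriented circles of $L$ (positive curvature) that lie between the two lines $\Re z=0$ and $\Re z=1$ and are not contained in the interior of another positively oriented circle of $L$. Then every circle of this packing belongs to $\mathcal{S}_D$ for the field $K$.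
   Context: An oriented circle $C$ is determined by $\zeta\in\mathbb{C}$, $r,\hat r\in\mathbb{R}$ with $|\zeta|^2-r\hat r=1$; as a point set $C=\{\alpha/\beta\in\widehat{\mathbb{C}}: r|\alpha|^2-2\Re(\overline{\alpha}\beta\zeta)+\hat r|\beta|^2=0\}$; $r$ is the curvature, $\zeta$ the curvature-center, $\hat r$ the cocurvature, $\mathbf{v}_C=[\zeta\;\overline{\zeta}\;\hat r\;r]$. If $r\neq0$, $C$ has center $\zeta/r$ and radius $1/|r|$, interior the side containing the center if $r>0$; if $r=0$ it is a line orthogonal to $\zeta$ with interior the side to which $\zeta$ points. For an imaginary quadratic field $K$ with ring of integers $\mathcal{O}$ and discriminant $\Delta<0$ ($\sqrt{\Delta}=i\sqrt{|\Delta|}$), $\mathcal{S}_D$ is the set of oriented circles with $i\sqrt{D}\,\mathbf{v}_C\in\mathcal{O}^2\times\sqrt{\Delta}\mathbb{Z}^2$. -}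

module Defs where

open import Data.Nat as ℕ using (ℕ; NonZero; _%_)
open import Data.Nat.Divisibility using (_∣_)
open import Data.Integer as ℤ using (ℤ; +_)
open import Data.Rational as ℚ using (ℚ; 0ℚ; 1ℚ; _+_; _*_; _-_; -_; _<_; _≤_; _/_; 1/_)
open import Data.Rational.Properties using (_≟_)
open import Data.Product using (Σ; ∃; ∃-syntax; _×_; _,_)
open import Relation.Binary.PropositionalEquality using (_≡_; _≢_)
open import Relation.Nullary using (¬_; yes; no)

-- Throughout, D : ℕ is the (positive) parameter, K = ℚ(i√D).
-- An element of K is written  re + im · i√D  with re, im ∈ ℚ.

ℕ→ℚ : ℕ → ℚ
ℕ→ℚ n = (+ n) / 1

ℤ→ℚ : ℤ → ℚ
ℤ→ℚ z = z / 1

record K : Set where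
  constructor _⊹_
  field
    re : ℚ
    im : ℚ
open K public

ofℚ : ℚ → K
ofℚ q = q ⊹ 0ℚ

addK : K → K → K
addK (a ⊹ b) (c ⊹ d) = (a + c) ⊹ (b + d)

subK : K → K → K
subK (a ⊹ b) (c ⊹ d) = (a - c) ⊹ (b - d)

-- (a + b i√D)(c + d i√D) = (ac − D bd) + (ad + bc) i√D
mulK : (D : ℕ) → K → K → K
mulK D (a ⊹ b) (c ⊹ d) = ((a * c) - (ℕ→ℚ D * (b * d))) ⊹ ((a * d) + (b * c))

zmulK : ℤ → K → K
zmulK z (a ⊹ b) = (ℤ→ℚ z * a) ⊹ (ℤ→ℚ z * b)

conjK : K → K
conjK (a ⊹ b) = a ⊹ (- b)

normSq : (D : ℕ) → K → ℚ
normSq D (a ⊹ b) = (a * a) + (ℕ→ℚ D * (b * b))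

zeroK : K
zeroK = 0ℚ ⊹ 0ℚ

iSqrtD : K
iSqrtD = 0ℚ ⊹ 1ℚ

record Circ : Set where
  constructor circ
  field
    ζ  : K     -- curvature-center
    r̂  : ℚ     -- cocurvature
    r  : ℚ     -- curvature
open Circ public

IsOrientedCircle : (D : ℕ) → Circ → Set
IsOrientedCircle D C = normSq D (ζ C) - (r C * r̂ C) ≡ 1ℚ

record Vec4 : Set where
  constructor v4
  field
    c₁ c₂ c₃ c₄ : K

vC : Circ → Vec4
vC C = v4 (ζ C) (conjK (ζ C)) (ofℚ (r̂ C)) (ofℚ (r C))

addV : Vec4 → Vec4 → Vec4
addV (v4 a b c d) (v4 a' b' c' d') = v4 (addK a a') (addK b b') (addK c c') (addK d d')

zmulV : ℤ → Vec4 → Vec4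
zmulV z (v4 a b c d) = v4 (zmulK z a) (zmulK z b) (zmulK z c) (zmulK z d)

-- C₁ : line Re z = 0, interior Re z < 0   : r = 0, ζ = −1 (unit normal towards interior), r̂ = 0
-- C₂ : line Re z = 1, interior Re z > 1   : r = 0, ζ = 1, r̂ = 2
-- C₃ : center 1/2, radius 1/2, positive   : r = 2, ζ = r·center = 1, r̂ = (|ζ|²−1)/r = 0
-- C₄ : center 1/2 + i√D, radius 1/2, pos. : r = 2, ζ = 1 + 2 i√D, r̂ = (1+4D−1)/2 = 2D

C₁ C₂ C₃ : Circ
C₁ = circ ((- 1ℚ) ⊹ 0ℚ) 0ℚ 0ℚ
C₂ = circ (1ℚ ⊹ 0ℚ) (ℕ→ℚ 2) 0ℚ
C₃ = circ (1ℚ ⊹ 0ℚ) 0ℚ (ℕ→ℚ 2)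

C₄ : (D : ℕ) → Circ
C₄ D = circ (1ℚ ⊹ ℕ→ℚ 2) (ℕ→ℚ (2 ℕ.* D)) (ℕ→ℚ 2)

InL : (D : ℕ) → Circ → Set
InL D C = ∃[ a ] ∃[ b ] ∃[ c ] ∃[ d ]
  (vC C ≡ addV (zmulV a (vC C₁)) (addV (zmulV b (vC C₂))
             (addV (zmulV c (vC C₃)) (zmulV d (vC (C₄ D))))))

-- total reciprocal (only used at r > 0)
inv : ℚ → ℚ
inv q with q ≟ 0ℚ
... | yes _  = 0ℚ
... | no q≢0 = 1/_ q {{ℚ.≢-nonZero q≢0}}

center : Circ → K
center C = (re (ζ C) * inv (r C)) ⊹ (im (ζ C) * inv (r C))

radius : Circ → ℚ
radius C = inv (r C)

Positive : Circ → Set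
Positive C = 0ℚ < r C

BetweenLines : Circ → Set
BetweenLines C = (0ℚ ≤ re (center C) - radius C) × (re (center C) + radius C ≤ 1ℚ)

-- (positive) circle C lies in the open disk bounded by positive circle C':
-- |center C − center C'| + radius C < radius C'
InInteriorOf : (D : ℕ) → Circ → Circ → Set
InInteriorOf D C C' =
  (radius C < radius C') ×
  (normSq D (subK (center C) (center C')) < ((radius C' - radius C) * (radius C' - radius C)))

InPacking : (D : ℕ) → Circ → Set
InPacking D C =
  IsOrientedCircle D C × InL D C × Positive C × BetweenLines C ×
  (∀ (C' : Circ) → IsOrientedCircle D C' → InL D C' → Positive C' → ¬ InInteriorOf D C C')

-- α ∈ 𝒪 : α is a root of a monic integer polynomial; in the quadratic field K
-- this is equivalent to being a root of some monic X² − tX + n with t, n ∈ ℤ.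
InO : (D : ℕ) → K → Set
InO D α = ∃[ t ] ∃[ n ]
  (addK (subK (mulK D α α) (zmulK t α)) (ofℚ (ℤ→ℚ n)) ≡ zeroK)

SquareFree : ℕ → Set
SquareFree n = ∀ m → (m ℕ.* m) ∣ n → m ≡ 1

-- Δ = −δ is the discriminant of K = ℚ(i√D): write D = f² D' with D' squarefree;
-- then δ = D' if D' ≡ 3 (mod 4) and δ = 4D' otherwise.
IsAbsDisc : (D δ : ℕ) → Set
IsAbsDisc D δ = ∃[ f ] ∃[ D' ]
  ((D ≡ f ℕ.* f ℕ.* D') × SquareFree D' ×
   (D' % 4 ≡ 3 → δ ≡ D') × (D' % 4 ≢ 3 → δ ≡ 4 ℕ.* D'))

IsSqrtΔ : (D δ : ℕ) → K → Set
IsSqrtΔ D δ s = (re s ≡ 0ℚ) × (0ℚ < im s) × (mulK D s s ≡ ofℚ (- ℕ→ℚ δ))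

InSqrtΔℤ : K → K → Set
InSqrtΔℤ s x = ∃[ m ] (x ≡ zmulK m s)

InSD : (D : ℕ) → Circ → Set
InSD D C = ∀ δ s → IsAbsDisc D δ → IsSqrtΔ D δ s →
  InO D (mulK D iSqrtD (ζ C)) × InO D (mulK D iSqrtD (conjK (ζ C))) ×
  InSqrtΔℤ s (mulK D iSqrtD (ofℚ (r̂ C))) × InSqrtΔℤ s (mulK D iSqrtD (ofℚ (r C)))

{-# OPTIONS --safe #-}
-- Indeed 𝒮_D-membership is ℤ-linear in v_C, and on the generators the
-- curvature-centers lie in ℤ[i√D] ⊆ 𝒪 while r and r̂ are even. Writing
-- D = f² D', one has √Δ = σ i√D with f σ ∈ {1, 2}, so 2 i√D ∈ √Δ ℤ.
module Submission where

open import Defs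
open import Data.Nat using (ℕ; NonZero)
import Data.Nat as ℕ
import Data.Nat.Properties as ℕP
open import Data.Integer as ℤ using (+_; -[1+_])
import Data.Integer.Properties as ℤP
open import Data.Rational as ℚ using (ℚ; 0ℚ; 1ℚ; _+_; _*_; _-_; -_; _<_)
import Data.Rational.Unnormalised as ℚᵘ
import Data.Rational.Unnormalised.Properties as ℚᵘP
import Data.Rational.Properties as ℚP
open import Data.Rational.Solver using (module +-*-Solver)
open import Data.Product using (∃-syntax; _×_; _,_)
open import Data.Sum using (_⊎_; inj₁; inj₂)
open import Data.Empty using (⊥-elim)
open import Function using (_∘_)
open import Relation.Nullary using (Dec; yes; no)
open import Relation.Binary.Definitions using (tri<; tri≈; tri>)
open import Relation.Binary.PropositionalEquality
open +-*-Solver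
open ≡-Reasoning

two : ℚ
two = ℕ→ℚ 2

ℤ→ℚ-≃ : ∀ z → ℚ.toℚᵘ (ℤ→ℚ z) ℚᵘ.≃ ℚᵘ.mkℚᵘ z 0
ℤ→ℚ-≃ z = ℚP.toℚᵘ-fromℚᵘ (ℚᵘ.mkℚᵘ z 0)

ℤ→ℚ-+ : ∀ x y → ℤ→ℚ (x ℤ.+ y) ≡ ℤ→ℚ x + ℤ→ℚ y
ℤ→ℚ-+ x y = ℚP.toℚᵘ-injective (ℚᵘP.≃-trans (ℤ→ℚ-≃ (x ℤ.+ y)) (ℚᵘP.≃-trans ≃-mkℚᵘ
  (ℚᵘP.≃-sym (ℚᵘP.≃-trans (ℚP.toℚᵘ-homo-+ (ℤ→ℚ x) (ℤ→ℚ y)) (ℚᵘP.+-cong (ℤ→ℚ-≃ x) (ℤ→ℚ-≃ y))))))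
  where
  ≃-mkℚᵘ : ℚᵘ.mkℚᵘ (x ℤ.+ y) 0 ℚᵘ.≃ (ℚᵘ.mkℚᵘ x 0 ℚᵘ.+ ℚᵘ.mkℚᵘ y 0)
  ≃-mkℚᵘ = ℚᵘ.*≡* (cong₂ (λ a b → (a ℤ.+ b) ℤ.* + 1) (sym (ℤP.*-identityʳ x)) (sym (ℤP.*-identityʳ y)))

ℤ→ℚ-* : ∀ x y → ℤ→ℚ (x ℤ.* y) ≡ ℤ→ℚ x * ℤ→ℚ y
ℤ→ℚ-* x y = ℚP.toℚᵘ-injective (ℚᵘP.≃-trans (ℤ→ℚ-≃ (x ℤ.* y))
  (ℚᵘP.≃-sym (ℚᵘP.≃-trans (ℚP.toℚᵘ-homo-* (ℤ→ℚ x) (ℤ→ℚ y)) (ℚᵘP.*-cong (ℤ→ℚ-≃ x) (ℤ→ℚ-≃ y)))))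

ℤ→ℚ-neg : ∀ x → ℤ→ℚ (ℤ.- x) ≡ - ℤ→ℚ x
ℤ→ℚ-neg x = ℚP.toℚᵘ-injective (ℚᵘP.≃-trans (ℤ→ℚ-≃ (ℤ.- x))
  (ℚᵘP.≃-sym (ℚᵘP.≃-trans (ℚP.toℚᵘ-homo‿- (ℤ→ℚ x)) (ℚᵘP.-‿cong (ℤ→ℚ-≃ x)))))

ℕ→ℚ-* : ∀ m n → ℕ→ℚ (m ℕ.* n) ≡ ℕ→ℚ m * ℕ→ℚ n
ℕ→ℚ-* m n = trans (cong ℤ→ℚ (ℤP.pos-* m n)) (ℤ→ℚ-* (+ m) (+ n))

ℕ→ℚ-pos : ∀ n .{{_ : NonZero n}} → 0ℚ < ℕ→ℚ n
ℕ→ℚ-pos n = ℚP.positive⁻¹ (ℕ→ℚ n) {{ℚP.normalize-pos n 1}}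

*-cancelʳ-≡ : ∀ p q r .{{_ : ℚ.NonZero r}} → p * r ≡ q * r → p ≡ q
*-cancelʳ-≡ p q r pr≡qr = begin
  p                  ≡⟨ sym (ℚP.*-identityʳ p) ⟩
  p * 1ℚ             ≡⟨ cong (p *_) (sym r*r⁻¹≡1) ⟩
  p * (r * ℚ.1/ r)   ≡⟨ sym (ℚP.*-assoc p r (ℚ.1/ r)) ⟩
  p * r * ℚ.1/ r     ≡⟨ cong (_* ℚ.1/ r) pr≡qr ⟩
  q * r * ℚ.1/ r     ≡⟨ ℚP.*-assoc q r (ℚ.1/ r) ⟩
  q * (r * ℚ.1/ r)   ≡⟨ cong (q *_) r*r⁻¹≡1 ⟩
  q * 1ℚ             ≡⟨ ℚP.*-identityʳ q ⟩
  q                  ∎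
  where
  r*r⁻¹≡1 : r * ℚ.1/ r ≡ 1ℚ
  r*r⁻¹≡1 = ℚP.*-inverseʳ r

square-mono-< : ∀ {p q} → 0ℚ < p → 0ℚ < q → p < q → p * p < q * q
square-mono-< {p} {q} 0<p 0<q p<q =
  ℚP.<-trans (ℚP.*-monoʳ-<-pos p {{ℚ.positive 0<p}} p<q) (ℚP.*-monoˡ-<-pos q {{ℚ.positive 0<q}} p<q)

pos-square-injective : ∀ {p q} → 0ℚ < p → 0ℚ < q → p * p ≡ q * q → p ≡ q
pos-square-injective 0<p 0<q p²≡q² with ℚP.<-cmp _ _
... | tri≈ _ p≡q _ = p≡q
... | tri< p<q _ _ = ⊥-elim (ℚP.<-irrefl p²≡q² (square-mono-< 0<p 0<q p<q))
... | tri> _ _ q<p = ⊥-elim (ℚP.<-irrefl (sym p²≡q²) (square-mono-< 0<q 0<p q<p))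

infix 4 _∈_·ℤ

_∈_·ℤ : ℚ → ℚ → Set
q ∈ c ·ℤ = ∃[ z ] (q ≡ ℤ→ℚ z * c)

ℤ→ℚ∈ℤ : ∀ z → ℤ→ℚ z ∈ 1ℚ ·ℤ
ℤ→ℚ∈ℤ z = z , sym (ℚP.*-identityʳ (ℤ→ℚ z))

∈·ℤ-+ : ∀ {c p q} → p ∈ c ·ℤ → q ∈ c ·ℤ → p + q ∈ c ·ℤ
∈·ℤ-+ {c} (x , refl) (y , refl) =
  x ℤ.+ y , trans (sym (ℚP.*-distribʳ-+ c (ℤ→ℚ x) (ℤ→ℚ y))) (cong (_* c) (sym (ℤ→ℚ-+ x y)))

∈·ℤ-neg : ∀ {c q} → q ∈ c ·ℤ → - q ∈ c ·ℤ
∈·ℤ-neg {c} (x , refl) =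
  ℤ.- x , trans (ℚP.neg-distribˡ-* (ℤ→ℚ x) c) (cong (_* c) (sym (ℤ→ℚ-neg x)))

∈·ℤ-* : ∀ {c p q} → p ∈ 1ℚ ·ℤ → q ∈ c ·ℤ → p * q ∈ c ·ℤ
∈·ℤ-* {c} (x , refl) (y , refl) = x ℤ.* y , (begin
  ℤ→ℚ x * 1ℚ * (ℤ→ℚ y * c)   ≡⟨ solve 3 (λ x y c → x :* con 1ℚ :* (y :* c) := x :* y :* c)
                                        refl (ℤ→ℚ x) (ℤ→ℚ y) c ⟩
  ℤ→ℚ x * ℤ→ℚ y * c          ≡⟨ cong (_* c) (sym (ℤ→ℚ-* x y)) ⟩
  ℤ→ℚ (x ℤ.* y) * c          ∎)

∈·ℤ-trans : ∀ {d c q} → c ∈ d ·ℤ → q ∈ c ·ℤ → q ∈ d ·ℤ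
∈·ℤ-trans {d} (x , refl) (y , refl) = y ℤ.* x , (begin
  ℤ→ℚ y * (ℤ→ℚ x * d)        ≡⟨ sym (ℚP.*-assoc (ℤ→ℚ y) (ℤ→ℚ x) d) ⟩
  ℤ→ℚ y * ℤ→ℚ x * d          ≡⟨ cong (_* d) (sym (ℤ→ℚ-* y x)) ⟩
  ℤ→ℚ (y ℤ.* x) * d          ∎)

∈·ℤ-linear-combination : ∀ a b c d {m x₁ x₂ x₃ x₄} →
  x₁ ∈ m ·ℤ → x₂ ∈ m ·ℤ → x₃ ∈ m ·ℤ → x₄ ∈ m ·ℤ →
  ℤ→ℚ a * x₁ + (ℤ→ℚ b * x₂ + (ℤ→ℚ c * x₃ + ℤ→ℚ d * x₄)) ∈ m ·ℤ
∈·ℤ-linear-combination a b c d x₁∈ x₂∈ x₃∈ x₄∈ =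
  ∈·ℤ-+ (a ⋆ x₁∈) (∈·ℤ-+ (b ⋆ x₂∈) (∈·ℤ-+ (c ⋆ x₃∈) (d ⋆ x₄∈)))
  where
  _⋆_ : ∀ {m x} z → x ∈ m ·ℤ → ℤ→ℚ z * x ∈ m ·ℤ
  z ⋆ x∈ = ∈·ℤ-* (ℤ→ℚ∈ℤ z) x∈

Inℤ[i√D] : K → Set
Inℤ[i√D] α = re α ∈ 1ℚ ·ℤ × im α ∈ 1ℚ ·ℤ

iSqrtD∈ℤ[i√D] : Inℤ[i√D] iSqrtD
iSqrtD∈ℤ[i√D] = (+ 0 , refl) , (+ 1 , refl)

Inℤ[i√D]-conjK : ∀ {α} → Inℤ[i√D] α → Inℤ[i√D] (conjK α)
Inℤ[i√D]-conjK {_ ⊹ _} (a∈ , b∈) = a∈ , ∈·ℤ-neg b∈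

Inℤ[i√D]-mulK : ∀ D {α β} → Inℤ[i√D] α → Inℤ[i√D] β → Inℤ[i√D] (mulK D α β)
Inℤ[i√D]-mulK D {_ ⊹ _} {_ ⊹ _} (a∈ , b∈) (c∈ , d∈) =
    ∈·ℤ-+ (∈·ℤ-* a∈ c∈) (∈·ℤ-neg (∈·ℤ-* (ℤ→ℚ∈ℤ (+ D)) (∈·ℤ-* b∈ d∈)))
  , ∈·ℤ-+ (∈·ℤ-* a∈ d∈) (∈·ℤ-* b∈ c∈)

Inℤ[i√D]⇒InO : ∀ D {α} → Inℤ[i√D] α → InO D α
Inℤ[i√D]⇒InO D {a ⊹ b} (a∈ , b∈)
  with t , 2a≡t ← ∈·ℤ-* (ℤ→ℚ∈ℤ (+ 2)) a∈
     | n , N≡n ← ∈·ℤ-+ (∈·ℤ-* a∈ a∈) (∈·ℤ-* (ℤ→ℚ∈ℤ (+ D)) (∈·ℤ-* b∈ b∈))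
  = t , n , cong₂ _⊹_ re≡0 im≡0
  where
  d : ℚ
  d = ℕ→ℚ D
  t≡2a : ℤ→ℚ t ≡ two * a
  t≡2a = trans (sym (ℚP.*-identityʳ (ℤ→ℚ t))) (sym 2a≡t)
  n≡N : ℤ→ℚ n ≡ a * a + d * (b * b)
  n≡N = trans (sym (ℚP.*-identityʳ (ℤ→ℚ n))) (sym N≡n)
  re≡0 : ((a * a - d * (b * b)) - ℤ→ℚ t * a) + ℤ→ℚ n ≡ 0ℚ
  re≡0 = begin
    ((a * a - d * (b * b)) - ℤ→ℚ t * a) + ℤ→ℚ n
      ≡⟨ cong₂ (λ t′ n′ → ((a * a - d * (b * b)) - t′ * a) + n′) t≡2a n≡N ⟩
    ((a * a - d * (b * b)) - two * a * a) + (a * a + d * (b * b))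
      ≡⟨ solve 3 (λ a b d → ((a :* a :- d :* (b :* b)) :- con two :* a :* a) :+ (a :* a :+ d :* (b :* b))
                            := con 0ℚ) refl a b d ⟩
    0ℚ ∎
  im≡0 : ((a * b + b * a) - ℤ→ℚ t * b) + 0ℚ ≡ 0ℚ
  im≡0 = begin
    ((a * b + b * a) - ℤ→ℚ t * b) + 0ℚ  ≡⟨ cong (λ t′ → ((a * b + b * a) - t′ * b) + 0ℚ) t≡2a ⟩
    ((a * b + b * a) - two * a * b) + 0ℚ ≡⟨ solve 2 (λ a b → ((a :* b :+ b :* a) :- con two :* a :* b) :+ con 0ℚ
                                                            := con 0ℚ) refl a b ⟩
    0ℚ ∎

InL⇒ζ∈ℤ[i√D] : ∀ D {C} → InL D C → Inℤ[i√D] (ζ C)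
InL⇒ζ∈ℤ[i√D] D (a , b , c , d , vC≡) =
    subst (_∈ 1ℚ ·ℤ) (sym (cong (re ∘ Vec4.c₁) vC≡))
      (∈·ℤ-linear-combination a b c d (-[1+ 0 ] , refl) (+ 1 , refl) (+ 1 , refl) (+ 1 , refl))
  , subst (_∈ 1ℚ ·ℤ) (sym (cong (im ∘ Vec4.c₁) vC≡))
      (∈·ℤ-linear-combination a b c d (+ 0 , refl) (+ 0 , refl) (+ 0 , refl) (+ 2 , refl))

InL⇒r̂∈2ℤ : ∀ D {C} → InL D C → r̂ C ∈ two ·ℤ
InL⇒r̂∈2ℤ D (a , b , c , d , vC≡) =
  subst (_∈ two ·ℤ) (sym (cong (re ∘ Vec4.c₃) vC≡))
    (∈·ℤ-linear-combination a b c d (+ 0 , refl) (+ 1 , refl) (+ 0 , refl) 2D∈2ℤ)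
  where
  2D∈2ℤ : ℕ→ℚ (2 ℕ.* D) ∈ two ·ℤ
  2D∈2ℤ = + D , trans (ℕ→ℚ-* 2 D) (ℚP.*-comm two (ℕ→ℚ D))

InL⇒r∈2ℤ : ∀ D {C} → InL D C → r C ∈ two ·ℤ
InL⇒r∈2ℤ D (a , b , c , d , vC≡) =
  subst (_∈ two ·ℤ) (sym (cong (re ∘ Vec4.c₄) vC≡))
    (∈·ℤ-linear-combination a b c d (+ 0 , refl) (+ 0 , refl) (+ 1 , refl) (+ 1 , refl))

IsSqrtΔ⇒D*im²≡δ : ∀ D δ {s} → IsSqrtΔ D δ s → ℕ→ℚ D * (im s * im s) ≡ ℕ→ℚ δ
IsSqrtΔ⇒D*im²≡δ D δ {_ ⊹ σ} (refl , _ , s²≡-δ) = ℚP.neg-injective (begin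
  - (ℕ→ℚ D * (σ * σ))          ≡⟨ solve 2 (λ d σ → :- (d :* (σ :* σ)) := con 0ℚ :* con 0ℚ :- d :* (σ :* σ))
                                         refl (ℕ→ℚ D) σ ⟩
  0ℚ * 0ℚ - ℕ→ℚ D * (σ * σ)    ≡⟨ cong re s²≡-δ ⟩
  - ℕ→ℚ δ                      ∎)

f*im√Δ≡1⊎2 : ∀ D .{{_ : NonZero D}} {δ s} → ((f , _) : IsAbsDisc D δ) → IsSqrtΔ D δ s →
             ℕ→ℚ f * im s ≡ 1ℚ ⊎ ℕ→ℚ f * im s ≡ two
f*im√Δ≡1⊎2 D {δ} {s} (f , D' , D≡f²D' , _ , δ≡D' , δ≡4D') √Δ@(_ , 0<σ , _) = by-residue (D' ℕ.% 4 ℕ.≟ 3)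
  where
  σ : ℚ
  σ = im s
  f²D'≢0 : NonZero (f ℕ.* f ℕ.* D')
  f²D'≢0 = ℕ.≢-nonZero (λ f²D'≡0 → ℕ.≢-nonZero⁻¹ D (trans D≡f²D' f²D'≡0))
  instance
    f≢0 : NonZero f
    f≢0 = ℕP.m*n≢0⇒m≢0 f {{ℕP.m*n≢0⇒m≢0 (f ℕ.* f) {{f²D'≢0}}}}
    D'≢0 : NonZero D'
    D'≢0 = ℕP.m*n≢0⇒n≢0 (f ℕ.* f) {{f²D'≢0}}
    D'ℚ≢0 : ℚ.NonZero (ℕ→ℚ D')
    D'ℚ≢0 = ℚP.pos⇒nonZero (ℕ→ℚ D') {{ℚ.positive (ℕ→ℚ-pos D')}}
  0<fσ : 0ℚ < ℕ→ℚ f * σ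
  0<fσ = ℚP.positive⁻¹ _ {{ℚP.pos*pos⇒pos (ℕ→ℚ f) {{ℚ.positive (ℕ→ℚ-pos f)}} σ {{ℚ.positive 0<σ}}}}
  fσ²D'≡δ : (ℕ→ℚ f * σ) * (ℕ→ℚ f * σ) * ℕ→ℚ D' ≡ ℕ→ℚ δ
  fσ²D'≡δ = begin
    (ℕ→ℚ f * σ) * (ℕ→ℚ f * σ) * ℕ→ℚ D'
      ≡⟨ solve 3 (λ f σ d → (f :* σ) :* (f :* σ) :* d := f :* f :* d :* (σ :* σ))
                 refl (ℕ→ℚ f) σ (ℕ→ℚ D') ⟩
    ℕ→ℚ f * ℕ→ℚ f * ℕ→ℚ D' * (σ * σ)
      ≡⟨ cong (λ m → m * (σ * σ)) (sym (trans (ℕ→ℚ-* (f ℕ.* f) D') (cong (_* ℕ→ℚ D') (ℕ→ℚ-* f f)))) ⟩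
    ℕ→ℚ (f ℕ.* f ℕ.* D') * (σ * σ)
      ≡⟨ cong (λ m → ℕ→ℚ m * (σ * σ)) (sym D≡f²D') ⟩
    ℕ→ℚ D * (σ * σ)
      ≡⟨ IsSqrtΔ⇒D*im²≡δ D δ √Δ ⟩
    ℕ→ℚ δ ∎
  fσ≡ : ∀ x → 0ℚ < x → ℕ→ℚ δ ≡ x * x * ℕ→ℚ D' → ℕ→ℚ f * σ ≡ x
  fσ≡ x 0<x δ≡x²D' =
    pos-square-injective 0<fσ 0<x (*-cancelʳ-≡ _ _ (ℕ→ℚ D') (trans fσ²D'≡δ δ≡x²D'))
  by-residue : Dec (D' ℕ.% 4 ≡ 3) → ℕ→ℚ f * σ ≡ 1ℚ ⊎ ℕ→ℚ f * σ ≡ two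
  by-residue (yes D'≡3) = inj₁ (fσ≡ 1ℚ (ℚP.positive⁻¹ 1ℚ) (begin
    ℕ→ℚ δ              ≡⟨ cong ℕ→ℚ (δ≡D' D'≡3) ⟩
    ℕ→ℚ D'             ≡⟨ sym (ℚP.*-identityˡ (ℕ→ℚ D')) ⟩
    1ℚ * 1ℚ * ℕ→ℚ D'   ∎))
  by-residue (no D'≢3) = inj₂ (fσ≡ two (ℕ→ℚ-pos 2) (begin
    ℕ→ℚ δ              ≡⟨ cong ℕ→ℚ (δ≡4D' D'≢3) ⟩
    ℕ→ℚ (4 ℕ.* D')     ≡⟨ ℕ→ℚ-* 4 D' ⟩
    two * two * ℕ→ℚ D' ∎))

two∈im√Δ·ℤ : ∀ D .{{_ : NonZero D}} {δ s} → IsAbsDisc D δ → IsSqrtΔ D δ s → two ∈ im s ·ℤ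
two∈im√Δ·ℤ D {s = s} disc@(f , _) √Δ with f*im√Δ≡1⊎2 D disc √Δ
... | inj₁ fσ≡1 = + (2 ℕ.* f) , (begin
  two                         ≡⟨ sym (ℚP.*-identityʳ two) ⟩
  two * 1ℚ                    ≡⟨ cong (two *_) (sym fσ≡1) ⟩
  two * (ℕ→ℚ f * im s)        ≡⟨ sym (ℚP.*-assoc two (ℕ→ℚ f) (im s)) ⟩
  two * ℕ→ℚ f * im s          ≡⟨ cong (_* im s) (sym (ℕ→ℚ-* 2 f)) ⟩
  ℕ→ℚ (2 ℕ.* f) * im s        ∎)
... | inj₂ fσ≡2 = + f , sym fσ≡2

*i√D∈√Δℤ : ∀ D {q s} → re s ≡ 0ℚ → q ∈ im s ·ℤ → InSqrtΔℤ s (mulK D iSqrtD (ofℚ q))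
*i√D∈√Δℤ D {s = _ ⊹ σ} refl (m , refl) = m , cong₂ _⊹_
  (solve 3 (λ d m σ → con 0ℚ :* (m :* σ) :- d :* (con 1ℚ :* con 0ℚ) := m :* con 0ℚ)
           refl (ℕ→ℚ D) (ℤ→ℚ m) σ)
  (solve 2 (λ m σ → con 0ℚ :* con 0ℚ :+ con 1ℚ :* (m :* σ) := m :* σ) refl (ℤ→ℚ m) σ)

proposition4p7 : (D : ℕ) → .{{_ : NonZero D}} → (C : Circ) → InPacking D C → InSD D C
proposition4p7 D C (_ , inL , _) δ s disc √Δ@(re≡0 , _) =
    Inℤ[i√D]⇒InO D (Inℤ[i√D]-mulK D iSqrtD∈ℤ[i√D] ζ∈)
  , Inℤ[i√D]⇒InO D (Inℤ[i√D]-mulK D iSqrtD∈ℤ[i√D] (Inℤ[i√D]-conjK ζ∈))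
  , *i√D∈√Δℤ D re≡0 (∈·ℤ-trans 2∈√Δℤ (InL⇒r̂∈2ℤ D inL))
  , *i√D∈√Δℤ D re≡0 (∈·ℤ-trans 2∈√Δℤ (InL⇒r∈2ℤ D inL))
  where
  ζ∈ : Inℤ[i√D] (ζ C)
  ζ∈ = InL⇒ζ∈ℤ[i√D] D inL
  2∈√Δℤ : two ∈ im s ·ℤ
  2∈√Δℤ = two∈im√Δ·ℤ D disc √Δ
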